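{- In every Ex-lattice, for all elements $a,c,e,f$: $a\wedge(c\vee e)\wedge\lnot\lnot f\le(a\wedge c)\vee(a\wedge e)\vee f$.
   Context: A fundamental lattice is a bounded lattice with unary $\lnot$ that is antitone, satisfies $a\wedge\lnot a=0$ and $a\le\lnot\lnot a$. An Ex-lattice is a fundamental lattice in which, for all $a,b,c,d,e,f$: $\lnot\big[a\wedge((b\wedge c)\vee(b\wedge d))\big]\wedge a\wedge(c\vee e)\wedge\lnot\lnot f \le \lnot\lnot(a\wedge f)\wedge\big[(a\wedge c)\vee(a\wedge e)\vee f\big]\wedge\big[(b\wedge(c\vee d))\vee\lnot(b\wedge(c\vee d))\big]$. -}

module Defs where

open import Level using (Level; _⊔_) renaming (suc to lsuc)
open import Relation.Binary.Lattice.Bundles using (BoundedLattice)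

record FundamentalLattice (c ℓ₁ ℓ₂ : Level) : Set (lsuc (c ⊔ ℓ₁ ⊔ ℓ₂)) where
  field
    boundedLattice : BoundedLattice c ℓ₁ ℓ₂
  open BoundedLattice boundedLattice public
  field
    ¬_         : Carrier → Carrier
    ¬-antitone : ∀ {a b} → a ≤ b → ¬ b ≤ ¬ a
    ∧-¬        : ∀ a → (a ∧ ¬ a) ≈ ⊥
    ≤-¬¬       : ∀ a → a ≤ ¬ (¬ a)

record ExLattice (c ℓ₁ ℓ₂ : Level) : Set (lsuc (c ⊔ ℓ₁ ⊔ ℓ₂)) where
  field
    fundamentalLattice : FundamentalLattice c ℓ₁ ℓ₂
  open FundamentalLattice fundamentalLattice public
  field
    ex : ∀ a b c d e f →
      ((((¬ (a ∧ ((b ∧ c) ∨ (b ∧ d)))) ∧ a) ∧ (c ∨ e)) ∧ ¬ (¬ f))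
        ≤ (((¬ (¬ (a ∧ f))) ∧ (((a ∧ c) ∨ (a ∧ e)) ∨ f))
             ∧ ((b ∧ (c ∨ d)) ∨ ¬ (b ∧ (c ∨ d))))

{-# OPTIONS --safe #-}
module Submission where

open import Defs
open import Level using (Level)
import Relation.Binary.Lattice.Properties.MeetSemilattice as MeetSemilatticeProperties
import Relation.Binary.Reasoning.PartialOrder as PosetReasoning

-- Instantiating (Ex) at b = d = ⊥ makes its first factor ¬ (a ∧ ((⊥ ∧ c) ∨ (⊥ ∧ ⊥))) = ¬ ⊥ = ⊤,
-- so the premise becomes a ∧ (c ∨ e) ∧ ¬ ¬ f, and the claim is the middle factor of the conclusion.

module FundamentalLatticeProperties {c ℓ₁ ℓ₂} (L : FundamentalLattice c ℓ₁ ℓ₂) where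
  open FundamentalLattice L

  ⊤≤¬⊥ : ⊤ ≤ ¬ ⊥
  ⊤≤¬⊥ = trans (≤-¬¬ ⊤) (¬-antitone (minimum (¬ ⊤)))

  x≤⊥⇒⊤≤¬x : ∀ {x} → x ≤ ⊥ → ⊤ ≤ ¬ x
  x≤⊥⇒⊤≤¬x x≤⊥ = trans ⊤≤¬⊥ (¬-antitone x≤⊥)

lemma3p5 : ∀ {ℓ₀ ℓ₁ ℓ₂ : Level} (L : ExLattice ℓ₀ ℓ₁ ℓ₂) →
    let open ExLattice L in
    ∀ a c e f → ((a ∧ (c ∨ e)) ∧ ¬ (¬ f)) ≤ (((a ∧ c) ∨ (a ∧ e)) ∨ f)
lemma3p5 L a c e f = begin
  (a ∧ (c ∨ e)) ∧ ¬ (¬ f)                          ≤⟨ ∧-monotonic (∧-monotonic a≤¬[a∧z]∧a refl) refl ⟩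
  ((¬ (a ∧ z) ∧ a) ∧ (c ∨ e)) ∧ ¬ (¬ f)            ≤⟨ ex a ⊥ c ⊥ e f ⟩
  (¬ (¬ (a ∧ f)) ∧ (((a ∧ c) ∨ (a ∧ e)) ∨ f)) ∧ _  ≤⟨ trans (x∧y≤x _ _) (x∧y≤y _ _) ⟩
  ((a ∧ c) ∨ (a ∧ e)) ∨ f                          ∎
  where
  open ExLattice L
  open FundamentalLatticeProperties fundamentalLattice
  open MeetSemilatticeProperties meetSemilattice using (∧-monotonic)
  open PosetReasoning poset

  z : Carrier
  z = (⊥ ∧ c) ∨ (⊥ ∧ ⊥)

  z≤⊥ : z ≤ ⊥
  z≤⊥ = ∨-least (x∧y≤x ⊥ c) (x∧y≤x ⊥ ⊥)

  a≤¬[a∧z]∧a : a ≤ ¬ (a ∧ z) ∧ a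
  a≤¬[a∧z]∧a = ∧-greatest (trans (maximum a) (x≤⊥⇒⊤≤¬x (trans (x∧y≤y a z) z≤⊥))) refl
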